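{- Let $m_1,m_2$ be positive integers and let $P_1=(x_1,x_2)$, $P_2=(y_1,y_2)$ be points of $\mathcal{S}^2$. Then there exists an integer $k\ge 0$ with $F^k(P_1)=P_2$ if and only if there exist $j,k'\in\{0,1\}$ such that \[2\gcd(m_1,m_2)\ \Big|\ (x_2-x_1)+\big((-1)^{j}y_2+(-1)^{k'}y_1\big).\]
   Context: $\mathcal{S}^2=\{(x_1,x_2)\in\mathbb{Z}^2: 0\le x_i\le m_i,\ i=1,2\}$ is the set of points of the $m_1\times m_2$ plane grid. For a positive integer $m$ let $\varphi_m:\mathbb{Z}\to\{0,\dots,m\}$, $\varphi_m(u)=\min_{n\in\mathbb{Z}}|u-2nm|$ (so $\varphi_m(u)=u$ for $0\le u\le m$, and $\varphi_m$ is even and $2m$-periodic). For $k\in\mathbb{Z}$ put $f_i^k(x)=\varphi_{m_i}(x+k)$ for $x\in\{0,\dots,m_i\}$, and $F^k(x_1,x_2)=(f_1^k(x_1),f_2^k(x_2))$. Thus $F^k(P)$ is the position, after $k$ unit diagonal steps, of a light beam starting at $P$ in direction $(+1,+1)$ inside the rectangle $[0,m_1]\times[0,m_2]$ with mirror boundary; "the light starting from $P_1$ passes through $P_2$" means $F^k(P_1)=P_2$ for some $k\ge0$. -}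

module Defs where

open import Data.Nat as ℕ using (ℕ; suc; _≤_; _∸_)
open import Data.Integer as ℤ using (ℤ; +_; _+_; _*_; -_; ∣_∣; _%_)
open import Data.Fin using (Fin; zero; suc)
open import Data.Nat.Properties using (m*n≢0)
open import Data.Product using (_×_; _,_)

-- φ_m(u) = min_{n ∈ ℤ} |u - 2 n m|  (m positive, written suc m').
-- Explicitly: with r = u mod 2m ∈ [0,2m), the nearest multiples of 2m are
-- u - r and u - r + 2m, so the minimum is min(r, 2m - r).
φ : (m : ℕ) → .{{_ : ℕ.NonZero m}} → ℤ → ℕ
φ m u = ℕ._⊓_ r ((2 ℕ.* m) ∸ r)
  where
  instance
    nz2m : ℕ.NonZero (2 ℕ.* m)
    nz2m = m*n≢0 2 m
  r : ℕ
  r = u % (+ (2 ℕ.* m))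

F : (m₁ m₂ : ℕ) → .{{_ : ℕ.NonZero m₁}} → .{{_ : ℕ.NonZero m₂}} →
    ℕ → ℕ × ℕ → ℕ × ℕ
F m₁ m₂ k (x₁ , x₂) = φ m₁ (+ x₁ + + k) , φ m₂ (+ x₂ + + k)

sgn : Fin 2 → ℤ
sgn zero    = ℤ.1ℤ
sgn (suc _) = ℤ.-1ℤ

{-# OPTIONS --safe #-}
-- φ_m(u) is the distance from u to 2mℤ, so for 0 ≤ y ≤ m we have φ_m(u) = y exactly when
-- u ≡ ±y (mod 2m). Hence P₁ reaches P₂ after k steps iff, for some choice of signs,
-- k ≡ ±y₁ − x₁ (mod 2m₁) and k ≡ ±y₂ − x₂ (mod 2m₂). By the Chinese remainder theorem such a
-- k ≥ 0 exists iff gcd(2m₁, 2m₂) = 2 gcd(m₁, m₂) divides the difference of the right-hand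
-- sides; flipping the sign in front of y₂ turns that difference into the theorem's expression.
module Submission where

open import Defs
open import Data.Nat as ℕ using (ℕ; _≤_)
open import Data.Integer as ℤ using (ℤ; +_; _+_; _-_; _*_; -_)
open import Data.Integer.Divisibility using (_∣_)
open import Data.Fin using (Fin; zero; suc; opposite)
open import Data.Nat.GCD using (gcd)
open import Data.Product using (_×_; _,_; ∃-syntax; proj₁; proj₂)
open import Function.Bundles using (_⇔_)
open import Relation.Binary.PropositionalEquality using (_≡_)

open import Function.Bundles using (mk⇔; Equivalence)
open Equivalence using (to; from)
open import Data.Sum using (inj₁; inj₂)
open import Relation.Binary.PropositionalEquality
  using (refl; sym; trans; cong; cong₂; subst; subst₂; module ≡-Reasoning)
open import Relation.Nullary using (contradiction)
open import Data.Fin.Properties using (opposite-involutive)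
open import Data.Product.Properties using (×-≡,≡→≡)
open import Data.Nat.Properties
  using (≤-total; ≤-antisym; ≤-trans; ≤-<-trans; m≤m+n; m<m+n; +-mono-≤; m∸n≤m;
         m+n≤o⇒m≤o∸n; m∸n≡0⇒m≤n; m∸n+n≡m; m∸[m∸n]≡n; ∸-monoʳ-<; <⇒≤;
         m≤n⇒m⊓n≡m; m≥n⇒m⊓n≡n; m*n≢0)
open import Data.Nat.Divisibility using (>⇒∤; m∣m*n; n∣m*n)
  renaming (_∣_ to _∣ℕ_)
open import Data.Nat.GCD
  using (gcd[m,n]∣m; gcd[m,n]∣n; gcd-GCD; c*gcd[m,n]≡gcd[cm,cn]; module Bézout)
open import Data.Integer.Properties
  using (*-identityˡ; -1*i≡-i; +-minus-telescope; neg-distribˡ-*; m-n≡m⊖n; ⊖-≥; pos-+; pos-*)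
open import Data.Integer.DivMod using (_%_; _/_; n%d<d; a≡a%n+[a/n]*n)
import Data.Integer.Divisibility.Signed as Signed
open Signed using (divides; ∣ᵤ⇒∣; ∣⇒∣ᵤ; ∣-trans; ∣m⇒∣-m; ∣m∣n⇒∣m+n)
open import Data.Integer.Tactic.RingSolver using (solve-∀)

infix 4 _≡_mod_

-- A record rather than the synonym + n ∣ a - b, so that a, b and n are inferable.
record _≡_mod_ (a b : ℤ) (n : ℕ) : Set where
  constructor mod-divides
  field
    divides-difference : + n Signed.∣ a - b

≡-mod-sym : ∀ {a b n} → a ≡ b mod n → b ≡ a mod n
≡-mod-sym {a} {b} (mod-divides n∣a-b) =
  mod-divides (subst (_ Signed.∣_) (negate-minus a b) (∣m⇒∣-m n∣a-b))
  where
  negate-minus : ∀ a b → - (a - b) ≡ b - a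
  negate-minus = solve-∀

≡-mod-trans : ∀ {a b c n} → a ≡ b mod n → b ≡ c mod n → a ≡ c mod n
≡-mod-trans {a} {b} {c} (mod-divides n∣a-b) (mod-divides n∣b-c) =
  mod-divides (subst (_ Signed.∣_) (+-minus-telescope a b c) (∣m∣n⇒∣m+n n∣a-b n∣b-c))

≡-mod-weaken : ∀ {a b d n} → d ∣ℕ n → a ≡ b mod n → a ≡ b mod d
≡-mod-weaken d∣n (mod-divides n∣a-b) = mod-divides (∣-trans (∣ᵤ⇒∣ d∣n) n∣a-b)

≡-mod-multiple : ∀ a q n → a + q * + n ≡ a mod n
≡-mod-multiple a q n = mod-divides (divides q (difference a q (+ n)))
  where
  difference : ∀ a q n → (a + q * n) - a ≡ q * n
  difference = solve-∀

≡-mod⇔∣ : ∀ {a b n} → (a ≡ b mod n) ⇔ (+ n ∣ a - b)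
≡-mod⇔∣ = mk⇔ (λ (mod-divides n∣a-b) → ∣⇒∣ᵤ n∣a-b) (λ n∣a-b → mod-divides (∣ᵤ⇒∣ n∣a-b))

+≡-mod⇔≡--mod : ∀ {a k c n} → (a + k ≡ c mod n) ⇔ (k ≡ c - a mod n)
+≡-mod⇔≡--mod {a} {k} {c} {n} = mk⇔
  (λ (mod-divides n∣a+k-c) → mod-divides (subst (_ Signed.∣_) (same-difference a k c) n∣a+k-c))
  (λ (mod-divides n∣k-[c-a]) →
     mod-divides (subst (_ Signed.∣_) (sym (same-difference a k c)) n∣k-[c-a]))
  where
  same-difference : ∀ a k c → (a + k) - c ≡ k - (c - a)
  same-difference = solve-∀

≡-mod-<⇒≡ : ∀ {a b n} → a ℕ.< n → b ℕ.< n → + a ≡ + b mod n → a ≡ b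
≡-mod-<⇒≡ a<n b<n a≡b = ≤-antisym (≡-mod-<⇒≤ a<n a≡b) (≡-mod-<⇒≤ b<n (≡-mod-sym a≡b))
  where
  ≡-mod-<⇒≤ : ∀ {a b n} → a ℕ.< n → + a ≡ + b mod n → a ≤ b
  ≡-mod-<⇒≤ {a} {b} a<n (mod-divides n∣a-b) with ≤-total a b
  ... | inj₁ a≤b = a≤b
  ... | inj₂ b≤a with a ℕ.∸ b in a∸b | subst (_ Signed.∣_) (trans (m-n≡m⊖n a b) (⊖-≥ b≤a)) n∣a-b
  ...   | ℕ.zero  | _     = m∸n≡0⇒m≤n a∸b
  ...   | ℕ.suc _ | n∣a∸b = contradiction (∣⇒∣ᵤ n∣a∸b)
                             (>⇒∤ (≤-<-trans (subst (_≤ a) a∸b (m∸n≤m a b)) a<n))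

m+n≡o⇒+m≡+o-+n : ∀ {m n o} → m ℕ.+ n ≡ o → + m ≡ + o - + n
m+n≡o⇒+m≡+o-+n {m} {n} {o} m+n≡o = begin
  + m               ≡⟨ isolate (+ m) (+ n) ⟩
  (+ m + + n) - + n ≡⟨ cong (_- + n) (trans (sym (pos-+ m n)) (cong +_ m+n≡o)) ⟩
  + o - + n         ∎
  where
  open ≡-Reasoning
  isolate : ∀ m n → m ≡ (m + n) - n
  isolate = solve-∀

neg-≡-mod-∸ : ∀ {y n} → y ≤ n → - + y ≡ + (n ℕ.∸ y) mod n
neg-≡-mod-∸ {y} {n} y≤n = mod-divides (divides ℤ.-1ℤ (begin
  - + y - + (n ℕ.∸ y)      ≡⟨ cong (λ z → - + y - z) (m+n≡o⇒+m≡+o-+n (m∸n+n≡m y≤n)) ⟩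
  - + y - (+ n - + y)      ≡⟨ cancel (+ y) (+ n) ⟩
  ℤ.-1ℤ * + n              ∎))
  where
  open ≡-Reasoning
  cancel : ∀ y n → - y - (n - y) ≡ ℤ.-1ℤ * n
  cancel = solve-∀

module _ (n : ℕ) .{{_ : ℕ.NonZero n}} where

  ≡-mod-% : ∀ a → a ≡ + (a % + n) mod n
  ≡-mod-% a = subst (_≡ + (a % + n) mod n) (sym (a≡a%n+[a/n]*n a (+ n)))
    (≡-mod-multiple (+ (a % + n)) (a / + n) n)

  %-unique : ∀ {a r} → r ℕ.< n → a ≡ + r mod n → a % + n ≡ r
  %-unique {a} r<n a≡r = ≡-mod-<⇒≡ (n%d<d a (+ n)) r<n (≡-mod-trans (≡-mod-sym (≡-mod-% a)) a≡r)

  ∃-ℕ-≡-mod : ∀ a → ∃[ k ] (+ k ≡ a mod n)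
  ∃-ℕ-≡-mod a = a % + n , ≡-mod-sym (≡-mod-% a)

bézout : ∀ m n → ∃[ s ] ∃[ t ] (+ gcd m n ≡ s * + m + t * + n)
bézout m n with Bézout.identity (gcd-GCD m n)
... | Bézout.+- x y g+yn≡xm = + x , - + y , (begin
  + gcd m n                 ≡⟨ m+n≡o⇒+m≡+o-+n g+yn≡xm ⟩
  + (x ℕ.* m) - + (y ℕ.* n) ≡⟨ cong₂ _-_ (pos-* x m) (pos-* y n) ⟩
  + x * + m - + y * + n     ≡⟨ cong (λ z → + x * + m + z) (neg-distribˡ-* (+ y) (+ n)) ⟩
  + x * + m + - + y * + n   ∎)
  where open ≡-Reasoning
... | Bézout.-+ x y g+xm≡yn = - + x , + y , (begin
  + gcd m n                 ≡⟨ m+n≡o⇒+m≡+o-+n g+xm≡yn ⟩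
  + (y ℕ.* n) - + (x ℕ.* m) ≡⟨ cong₂ _-_ (pos-* y n) (pos-* x m) ⟩
  + y * + n - + x * + m     ≡⟨ reorder (+ y * + n) (+ x) (+ m) ⟩
  - + x * + m + + y * + n   ∎)
  where
  open ≡-Reasoning
  reorder : ∀ a x m → a - x * m ≡ (- x) * m + a
  reorder = solve-∀

chinese-remainder : ∀ n₁ n₂ .{{_ : ℕ.NonZero n₁}} .{{_ : ℕ.NonZero n₂}} a b →
  (∃[ k ] (+ k ≡ a mod n₁ × + k ≡ b mod n₂)) ⇔ (a ≡ b mod gcd n₁ n₂)
chinese-remainder n₁ n₂ a b = mk⇔ necessary sufficient
  where
  necessary : ∃[ k ] (+ k ≡ a mod n₁ × + k ≡ b mod n₂) → a ≡ b mod gcd n₁ n₂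
  necessary (k , k≡a , k≡b) = ≡-mod-trans (≡-mod-sym (≡-mod-weaken (gcd[m,n]∣m n₁ n₂) k≡a))
                                          (≡-mod-weaken (gcd[m,n]∣n n₁ n₂) k≡b)

  sufficient : a ≡ b mod gcd n₁ n₂ → ∃[ k ] (+ k ≡ a mod n₁ × + k ≡ b mod n₂)
  sufficient (mod-divides (divides c a-b≡cg)) with bézout n₁ n₂
  ... | s , t , g≡sn₁+tn₂ with ∃-ℕ-≡-mod (n₁ ℕ.* n₂) {{m*n≢0 n₁ n₂}} (a - c * s * + n₁)
  ...   | k , k≡k₀ = k , ≡-mod-trans (≡-mod-weaken (m∣m*n n₂) k≡k₀) k₀≡a
                       , ≡-mod-trans (≡-mod-weaken (n∣m*n n₁) k≡k₀) k₀≡b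
    where
    -- From a - b = c (s n₁ + t n₂): k₀ = a - c s n₁ = b + c t n₂ solves both congruences.
    k₀ : ℤ
    k₀ = a - c * s * + n₁

    k₀≡a : k₀ ≡ a mod n₁
    k₀≡a = mod-divides (divides (- (c * s)) (difference a (c * s) (+ n₁)))
      where
      difference : ∀ a p n → (a - p * n) - a ≡ (- p) * n
      difference = solve-∀

    k₀≡b : k₀ ≡ b mod n₂
    k₀≡b = mod-divides (divides (c * t) (begin
      k₀ - b                                   ≡⟨ regroup a b (c * s * + n₁) ⟩
      (a - b) - c * s * + n₁                   ≡⟨ cong (λ z → z - c * s * + n₁) a-b≡cg ⟩
      c * + gcd n₁ n₂ - c * s * + n₁           ≡⟨ cong (λ z → c * z - c * s * + n₁) g≡sn₁+tn₂ ⟩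
      c * (s * + n₁ + t * + n₂) - c * s * + n₁ ≡⟨ cancel c s t (+ n₁) (+ n₂) ⟩
      c * t * + n₂                             ∎))
      where
      open ≡-Reasoning
      regroup : ∀ a b p → (a - p) - b ≡ (a - b) - p
      regroup = solve-∀
      cancel : ∀ c s t n₁ n₂ → c * (s * n₁ + t * n₂) - c * s * n₁ ≡ c * t * n₂
      cancel = solve-∀

instance
  2*-nonZero : ∀ {m} → .{{_ : ℕ.NonZero m}} → ℕ.NonZero (2 ℕ.* m)
  2*-nonZero {m} = m*n≢0 2 m

≡-mod-±⊓∸ : ∀ {u r n} → r ≤ n → u ≡ + r mod n →
            ∃[ s ] (u ≡ sgn s * + (r ℕ.⊓ (n ℕ.∸ r)) mod n)
≡-mod-±⊓∸ {u} {r} {n} r≤n u≡r with ≤-total r (n ℕ.∸ r)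
... | inj₁ r≤n-r = zero , subst (λ z → u ≡ z mod n) r≡min u≡r
  where
  r≡min : + r ≡ ℤ.1ℤ * + (r ℕ.⊓ (n ℕ.∸ r))
  r≡min = trans (sym (*-identityˡ _)) (cong (λ z → ℤ.1ℤ * + z) (sym (m≤n⇒m⊓n≡m r≤n-r)))
... | inj₂ n-r≤r = suc zero , subst (λ z → u ≡ z mod n) -[n-r]≡-min (≡-mod-trans u≡r r≡-[n-r])
  where
  r≡-[n-r] : + r ≡ - + (n ℕ.∸ r) mod n
  r≡-[n-r] = ≡-mod-sym (subst (λ z → - + (n ℕ.∸ r) ≡ + z mod n) (m∸[m∸n]≡n r≤n)
                               (neg-≡-mod-∸ (m∸n≤m n r)))
  -[n-r]≡-min : - + (n ℕ.∸ r) ≡ ℤ.-1ℤ * + (r ℕ.⊓ (n ℕ.∸ r))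
  -[n-r]≡-min = trans (sym (-1*i≡-i _)) (cong (λ z → ℤ.-1ℤ * + z) (sym (m≥n⇒m⊓n≡n n-r≤r)))

module _ (m : ℕ) .{{_ : ℕ.NonZero m}} where

  y≤m⇒y≤2m∸y : ∀ {y} → y ≤ m → y ≤ 2 ℕ.* m ℕ.∸ y
  y≤m⇒y≤2m∸y {y} y≤m = m+n≤o⇒m≤o∸n y (+-mono-≤ y≤m (≤-trans y≤m (m≤m+n m 0)))

  y≤m⇒y<2m : ∀ {y} → y ≤ m → y ℕ.< 2 ℕ.* m
  y≤m⇒y<2m y≤m = ≤-<-trans y≤m (m<m+n m (≤-trans (ℕ.>-nonZero⁻¹ m) (m≤m+n m 0)))

  %≡⇒φ≡ : ∀ {u y} → u % + (2 ℕ.* m) ≡ y → y ≤ m → φ m u ≡ y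
  %≡⇒φ≡ refl y≤m = m≤n⇒m⊓n≡m (y≤m⇒y≤2m∸y y≤m)

  %≡∸⇒φ≡ : ∀ {u y} → u % + (2 ℕ.* m) ≡ 2 ℕ.* m ℕ.∸ y → y ≤ m → φ m u ≡ y
  %≡∸⇒φ≡ {u} {y} u%2m≡2m-y y≤m
    rewrite u%2m≡2m-y | m∸[m∸n]≡n (<⇒≤ (y≤m⇒y<2m y≤m))
    = m≥n⇒m⊓n≡n (y≤m⇒y≤2m∸y y≤m)

  ≡-mod-±⇒φ≡ : ∀ {u y} s → y ≤ m → u ≡ sgn s * + y mod 2 ℕ.* m → φ m u ≡ y
  ≡-mod-±⇒φ≡ {u} {y} zero y≤m u≡y = %≡⇒φ≡ {u} (%-unique (2 ℕ.* m) (y≤m⇒y<2m y≤m) u≡y′) y≤m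
    where
    u≡y′ : u ≡ + y mod 2 ℕ.* m
    u≡y′ = subst (λ z → u ≡ z mod 2 ℕ.* m) (*-identityˡ (+ y)) u≡y
  -- for y = 0 the two signs give definitionally the same congruence
  ≡-mod-±⇒φ≡ {y = ℕ.zero} (suc zero) = ≡-mod-±⇒φ≡ zero
  ≡-mod-±⇒φ≡ {u} {y@(ℕ.suc _)} (suc zero) y≤m u≡-y =
    %≡∸⇒φ≡ {u} (%-unique (2 ℕ.* m) 2m-y<2m u≡2m-y) y≤m
    where
    y≤2m : y ≤ 2 ℕ.* m
    y≤2m = <⇒≤ (y≤m⇒y<2m y≤m)
    2m-y<2m : 2 ℕ.* m ℕ.∸ y ℕ.< 2 ℕ.* m
    2m-y<2m = ∸-monoʳ-< ℕ.z<s y≤2m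
    u≡2m-y : u ≡ + (2 ℕ.* m ℕ.∸ y) mod 2 ℕ.* m
    u≡2m-y = ≡-mod-trans (subst (λ z → u ≡ z mod 2 ℕ.* m) (-1*i≡-i (+ y)) u≡-y)
                         (neg-≡-mod-∸ y≤2m)

  ≡-mod-±φ : ∀ u → ∃[ s ] (u ≡ sgn s * + φ m u mod 2 ℕ.* m)
  ≡-mod-±φ u = ≡-mod-±⊓∸ (<⇒≤ (n%d<d u (+ (2 ℕ.* m)))) (≡-mod-% (2 ℕ.* m) u)

  φ≡⇔≡-mod-± : ∀ {u y} → y ≤ m → (φ m u ≡ y) ⇔ (∃[ s ] (u ≡ sgn s * + y mod 2 ℕ.* m))
  φ≡⇔≡-mod-± {u} y≤m = mk⇔ (λ { refl → ≡-mod-±φ u }) (λ (s , u≡±y) → ≡-mod-±⇒φ≡ s y≤m u≡±y)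

  φ[x+k]≡y⇔ : ∀ {x y} k → y ≤ m →
              (φ m (+ x + + k) ≡ y) ⇔ (∃[ s ] (+ k ≡ sgn s * + y - + x mod 2 ℕ.* m))
  φ[x+k]≡y⇔ {x} k y≤m = mk⇔
    (λ φ≡y → let s , x+k≡±y = to (φ≡⇔≡-mod-± {+ x + + k} y≤m) φ≡y
             in s , to (+≡-mod⇔≡--mod {+ x}) x+k≡±y)
    (λ (s , k≡±y-x) →
       from (φ≡⇔≡-mod-± {+ x + + k} y≤m) (s , from (+≡-mod⇔≡--mod {+ x}) k≡±y-x))

F≡⇔≡-mod-± : ∀ m₁ m₂ .{{_ : ℕ.NonZero m₁}} .{{_ : ℕ.NonZero m₂}} {x₁ x₂ y₁ y₂} k →
             y₁ ≤ m₁ → y₂ ≤ m₂ →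
             (F m₁ m₂ k (x₁ , x₂) ≡ (y₁ , y₂))
             ⇔ (∃[ s₁ ] ∃[ s₂ ] (+ k ≡ sgn s₁ * + y₁ - + x₁ mod 2 ℕ.* m₁
                                × + k ≡ sgn s₂ * + y₂ - + x₂ mod 2 ℕ.* m₂))
F≡⇔≡-mod-± m₁ m₂ k y₁≤m₁ y₂≤m₂ = mk⇔
  (λ Fk≡y → let s₁ , k≡t₁ = to (φ[x+k]≡y⇔ m₁ k y₁≤m₁) (cong proj₁ Fk≡y)
                s₂ , k≡t₂ = to (φ[x+k]≡y⇔ m₂ k y₂≤m₂) (cong proj₂ Fk≡y)
            in s₁ , s₂ , k≡t₁ , k≡t₂)
  (λ (s₁ , s₂ , k≡t₁ , k≡t₂) →
     ×-≡,≡→≡ (from (φ[x+k]≡y⇔ m₁ k y₁≤m₁) (s₁ , k≡t₁) , from (φ[x+k]≡y⇔ m₂ k y₂≤m₂) (s₂ , k≡t₂)))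

sgn-opposite : ∀ s → sgn (opposite s) ≡ - sgn s
sgn-opposite zero       = refl
sgn-opposite (suc zero) = refl

targets≡-mod-gcd⇔∣ : ∀ m₁ m₂ x₁ x₂ y₁ y₂ s₁ j →
  (sgn s₁ * + y₁ - + x₁ ≡ sgn (opposite j) * + y₂ - + x₂ mod gcd (2 ℕ.* m₁) (2 ℕ.* m₂))
  ⇔ (+ (2 ℕ.* gcd m₁ m₂) ∣ (+ x₂ - + x₁) + (sgn j * + y₂ + sgn s₁ * + y₁))
targets≡-mod-gcd⇔∣ m₁ m₂ x₁ x₂ y₁ y₂ s₁ j =
  subst₂ (λ n z → (t₁ ≡ t₂ mod gcd (2 ℕ.* m₁) (2 ℕ.* m₂)) ⇔ (+ n ∣ z))
    (sym (c*gcd[m,n]≡gcd[cm,cn] 2 m₁ m₂)) difference (≡-mod⇔∣ {t₁} {t₂})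
  where
  t₁ t₂ : ℤ
  t₁ = sgn s₁ * + y₁ - + x₁
  t₂ = sgn (opposite j) * + y₂ - + x₂
  rearrange : ∀ σ₁ σ x₁ x₂ y₁ y₂ →
              (σ₁ * y₁ - x₁) - ((- σ) * y₂ - x₂) ≡ (x₂ - x₁) + (σ * y₂ + σ₁ * y₁)
  rearrange = solve-∀
  difference : t₁ - t₂ ≡ (+ x₂ - + x₁) + (sgn j * + y₂ + sgn s₁ * + y₁)
  difference = trans (cong (λ σ → (sgn s₁ * + y₁ - + x₁) - (σ * + y₂ - + x₂)) (sgn-opposite j))
                     (rearrange (sgn s₁) (sgn j) (+ x₁) (+ x₂) (+ y₁) (+ y₂))

theorem3p4 : (m₁ m₂ : ℕ) → .{{_ : ℕ.NonZero m₁}} → .{{_ : ℕ.NonZero m₂}} →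
    (x₁ x₂ y₁ y₂ : ℕ) → x₁ ≤ m₁ → x₂ ≤ m₂ → y₁ ≤ m₁ → y₂ ≤ m₂ →
    (∃[ k ] (F m₁ m₂ k (x₁ , x₂) ≡ (y₁ , y₂)))
    ⇔ (∃[ j ] ∃[ k′ ] ((+ (2 ℕ.* gcd m₁ m₂)) ∣ ((+ x₂ - + x₁) + (sgn j * + y₂ + sgn k′ * + y₁))))
theorem3p4 m₁ m₂ x₁ x₂ y₁ y₂ _ _ y₁≤m₁ y₂≤m₂ = mk⇔
  (λ (k , Fk≡y) →
     let s₁ , s₂ , k≡t₁ , k≡t₂ = to (F≡⇔≡-mod-± m₁ m₂ k y₁≤m₁ y₂≤m₂) Fk≡y
         k≡t₂′ = subst (λ s → + k ≡ sgn s * + y₂ - + x₂ mod 2 ℕ.* m₂)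
                       (sym (opposite-involutive s₂)) k≡t₂
     in opposite s₂ , s₁ ,
        to (targets≡-mod-gcd⇔∣ m₁ m₂ x₁ x₂ y₁ y₂ s₁ (opposite s₂))
           (to (chinese-remainder (2 ℕ.* m₁) (2 ℕ.* m₂) _ _) (k , k≡t₁ , k≡t₂′)))
  (λ (j , s₁ , 2g∣d) →
     let k , k≡t₁ , k≡t₂ = from (chinese-remainder (2 ℕ.* m₁) (2 ℕ.* m₂) _ _)
                                (from (targets≡-mod-gcd⇔∣ m₁ m₂ x₁ x₂ y₁ y₂ s₁ j) 2g∣d)
     in k , from (F≡⇔≡-mod-± m₁ m₂ k y₁≤m₁ y₂≤m₂) (s₁ , opposite j , k≡t₁ , k≡t₂))
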